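{- Let $G=(V_1\sqcup V_2,E)$ be a 2SUIIG with upper partition $V_2$, given by a fixed 2SUIIG representation. Then for every vertex $v\in V_1$ we have $|N_B(v)|\le 2$. Moreover, if $N_B(v)=\{x,z\}$, then there is no vertex $y\in V_2$ with $s_x<s_y<s_z$.
   Context: Fix $\epsilon\in(0,1)$; stab lines are $y=1$ (lower) and $y=2+\epsilon$ (upper). A 2SUIG representation of a graph is a family of axis-parallel unit squares, one per vertex, each intersecting one of the two stab lines, whose intersection graph is the graph; $V_1$ (lower partition) are the vertices whose squares meet $y=1$ and $V_2$ (upper partition) those meeting $y=2+\epsilon$. A 2SUIIG is a graph with a 2SUIG representation (a 2SUIIG representation) in which $V_2$ induces an independent set. Bridge edges are edges between $V_1$ and $V_2$; $N_B(v)$ is the set of vertices joined to $v$ by a bridge edge. For a vertex $v$, $s_v$ is the $x$-coordinate of the bottom-left corner of the unit square representing $v$ in the fixed representation.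
   Formalization: The constant ε and the bottom-left corner coordinates of the unit squares in the 2SUIIG representation are rational rather than real. -}

module Defs where

open import Data.Nat using (ℕ)
open import Data.Bool using (Bool; true; false; _∧_)
open import Data.Fin using (Fin)
open import Data.Fin.Subset using (Subset)
open import Data.Vec using (tabulate)
open import Data.Product using (_×_)
open import Data.Rational using (ℚ; 1ℚ; _+_; _-_; ∣_∣; _≤_; _≤?_)
open import Relation.Nullary using (¬_; does)
open import Relation.Nullary.Decidable using (_×-dec_)
open import Relation.Binary.PropositionalEquality using (_≡_; _≢_)

-- Closed axis-parallel unit squares [s, s+1] × [t, t+1] given by the
-- bottom-left corner (s, t).  Two such squares intersect iff
-- |s - s'| ≤ 1 and |t - t'| ≤ 1.
SquaresMeet : ℚ → ℚ → ℚ → ℚ → Set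
SquaresMeet s t s' t' = (∣ s - s' ∣ ≤ 1ℚ) × (∣ t - t' ∣ ≤ 1ℚ)

squaresMeet? : (s t s' t' : ℚ) → Bool
squaresMeet? s t s' t' = does ((∣ s - s' ∣ ≤? 1ℚ) ×-dec (∣ t - t' ∣ ≤? 1ℚ))

MeetsLine : ℚ → ℚ → Set
MeetsLine c t = (t ≤ c) × (c ≤ t + 1ℚ)

stabLine : ℚ → Bool → ℚ
stabLine ε false = 1ℚ
stabLine ε true  = 1ℚ + 1ℚ + ε

-- The graph is the intersection graph of the squares (u ≠ v adjacent iff
-- their squares intersect).
record Rep2SUIIG (n : ℕ) (ε : ℚ) : Set where
  field
    s     : Fin n → ℚ
    t     : Fin n → ℚ
    upper : Fin n → Bool
    stab  : ∀ v → MeetsLine (stabLine ε (upper v)) (t v)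
    indep : ∀ u v → u ≢ v → upper u ≡ true → upper v ≡ true →
            ¬ SquaresMeet (s u) (t u) (s v) (t v)

  InV₁ : Fin n → Set
  InV₁ v = upper v ≡ false

  InV₂ : Fin n → Set
  InV₂ v = upper v ≡ true

  NB : Fin n → Subset n
  NB v = tabulate (λ u → upper u ∧ squaresMeet? (s v) (t v) (s u) (t u))

-- All upper squares meet the line y = 2 + ε, so their bottom edges lie in the
-- unit interval [1 + ε, 2 + ε] and any two of them overlap vertically; as V₂ is
-- independent, the x-coordinates s of two distinct upper vertices never lie in
-- a common unit interval.  A bridge neighbour u of v has s u ∈ [s v - 1, s v + 1],
-- the union of two unit intervals, so v has at most two of them; and if
-- s x < s y < s z with x, z ∈ N_B(v), then y shares [s v - 1, s v] with x or
-- [s v, s v + 1] with z.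
module Submission where

open import Defs
open import Data.Bool.Properties using (T-≡; T-∧)
open import Data.Fin using (Fin; zero; suc; _≟_)
open import Data.Fin.Properties using (suc-injective; injective⇒≤)
open import Data.Fin.Subset using (Subset; inside; outside; _∈_; ∣_∣; ⁅_⁆; _∪_)
open import Data.Fin.Subset.Properties using (x∈⁅x⁆; p⊆p∪q; q⊆p∪q)
open import Data.Nat using (ℕ)
open import Data.Product using (_×_; _,_; proj₁; proj₂)
open import Data.Rational as ℚ using (ℚ; 0ℚ; 1ℚ; _+_; _-_; -_; _≤_; _<_; _≤?_)
open import Data.Rational.Properties
  using (≤-reflexive; ≤-trans; ≤-total; ≰⇒>; <⇒≤; <-irrefl; neg-antimono-≤; +-mono-≤;
         +-monoˡ-≤; ∣p∣≡p∨∣p∣≡-p; ∣-p∣≡∣p∣; 0≤∣p∣; +-0-group; module ≤-Reasoning)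
open import Algebra.Properties.Group +-0-group using (⁻¹-involutive)
open import Data.Rational.Solver using (module +-*-Solver)
open import Data.Sum using (inj₁; inj₂; [_,_])
open import Data.Empty using (⊥; ⊥-elim)
open import Data.Bool using (T; true; _∧_)
open import Data.Vec using (_∷_; here; there)
open import Data.Vec.Properties using (lookup∘tabulate; []=⇒lookup)
open import Function using (_∘_; Injective; Equivalence)
open import Relation.Nullary using (¬_; Dec; does; yes; no)
open import Relation.Nullary.Decidable using (_×-dec_)
open import Relation.Binary.PropositionalEquality
  using (_≡_; refl; sym; trans; cong; subst; subst₂)
import Data.Nat as ℕ

open +-*-Solver

enumerate : ∀ {n} (p : Subset n) → Fin ∣ p ∣ → Fin n
enumerate (inside  ∷ p) zero    = zero
enumerate (inside  ∷ p) (suc k) = suc (enumerate p k)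
enumerate (outside ∷ p) k       = suc (enumerate p k)

enumerate-∈ : ∀ {n} (p : Subset n) k → enumerate p k ∈ p
enumerate-∈ (inside  ∷ p) zero    = here
enumerate-∈ (inside  ∷ p) (suc k) = there (enumerate-∈ p k)
enumerate-∈ (outside ∷ p) k       = there (enumerate-∈ p k)

enumerate-injective : ∀ {n} (p : Subset n) → Injective _≡_ _≡_ (enumerate p)
enumerate-injective (inside  ∷ p) {zero}  {zero}  _ = refl
enumerate-injective (inside  ∷ p) {zero}  {suc _} ()
enumerate-injective (inside  ∷ p) {suc _} {zero}  ()
enumerate-injective (inside  ∷ p) {suc k} {suc l} e =
  cong suc (enumerate-injective p (suc-injective e))
enumerate-injective (outside ∷ p) e = enumerate-injective p (suc-injective e)

injectiveOn⇒∣p∣≤ : ∀ {n m} {p : Subset n} (f : Fin n → Fin m) →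
  (∀ {i j} → i ∈ p → j ∈ p → f i ≡ f j → i ≡ j) → ∣ p ∣ ℕ.≤ m
injectiveOn⇒∣p∣≤ {p = p} f f-inj = injective⇒≤ λ {k} {l} e →
  enumerate-injective p (f-inj (enumerate-∈ p k) (enumerate-∈ p l) e)

p≤∣p∣ : ∀ p → p ≤ ℚ.∣ p ∣
p≤∣p∣ p with ∣p∣≡p∨∣p∣≡-p p
... | inj₁ ∣p∣≡p  = ≤-reflexive (sym ∣p∣≡p)
... | inj₂ ∣p∣≡-p = ≤-trans p≤0 (0≤∣p∣ p)
  where
  p≤0 : p ≤ 0ℚ
  p≤0 = subst (_≤ 0ℚ) (⁻¹-involutive p)
          (neg-antimono-≤ (subst (0ℚ ≤_) ∣p∣≡-p (0≤∣p∣ p)))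

∣p∣≤q⇒-q≤p≤q : ∀ p {q} → ℚ.∣ p ∣ ≤ q → - q ≤ p × p ≤ q
∣p∣≤q⇒-q≤p≤q p ∣p∣≤q =
    subst (_ ≤_) (⁻¹-involutive p)
      (neg-antimono-≤ (≤-trans (p≤∣p∣ (- p)) (subst (_≤ _) (sym (∣-p∣≡∣p∣ p)) ∣p∣≤q)))
  , ≤-trans (p≤∣p∣ p) ∣p∣≤q

-q≤p≤q⇒∣p∣≤q : ∀ {p q} → - q ≤ p → p ≤ q → ℚ.∣ p ∣ ≤ q
-q≤p≤q⇒∣p∣≤q {p} {q} -q≤p p≤q with ∣p∣≡p∨∣p∣≡-p p
... | inj₁ ∣p∣≡p  = subst (_≤ q) (sym ∣p∣≡p) p≤q
... | inj₂ ∣p∣≡-p =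
  subst₂ _≤_ (sym ∣p∣≡-p) (⁻¹-involutive q) (neg-antimono-≤ -q≤p)

infix 4 _∈[_,+1]

_∈[_,+1] : ℚ → ℚ → Set
x ∈[ a ,+1] = a ≤ x × x ≤ a + 1ℚ

p-1+1≡p : ∀ p → (p - 1ℚ) + 1ℚ ≡ p
p-1+1≡p = solve 1 (λ p → (p :- con 1ℚ) :+ con 1ℚ := p) refl

∈[,+1]⇒∣-∣≤1 : ∀ {a x y} → x ∈[ a ,+1] → y ∈[ a ,+1] → ℚ.∣ x - y ∣ ≤ 1ℚ
∈[,+1]⇒∣-∣≤1 {a} {x} {y} (a≤x , x≤a+1) (a≤y , y≤a+1) = -q≤p≤q⇒∣p∣≤q -1≤x-y x-y≤1
  where
  open ≤-Reasoning
  -1≤x-y : - 1ℚ ≤ x - y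
  -1≤x-y = begin
    - 1ℚ           ≡⟨ solve 1 (λ a → :- con 1ℚ := a :- (a :+ con 1ℚ)) refl a ⟩
    a - (a + 1ℚ)   ≤⟨ +-mono-≤ a≤x (neg-antimono-≤ y≤a+1) ⟩
    x - y          ∎
  x-y≤1 : x - y ≤ 1ℚ
  x-y≤1 = begin
    x - y          ≤⟨ +-mono-≤ x≤a+1 (neg-antimono-≤ a≤y) ⟩
    (a + 1ℚ) - a   ≡⟨ solve 1 (λ a → (a :+ con 1ℚ) :- a := con 1ℚ) refl a ⟩
    1ℚ             ∎

ordered⇒∈[,+1] : ∀ {a x y} → a ≤ x → x ≤ y → y ≤ a + 1ℚ → x ∈[ a ,+1] × y ∈[ a ,+1]
ordered⇒∈[,+1] a≤x x≤y y≤a+1 = (a≤x , ≤-trans x≤y y≤a+1) , (≤-trans a≤x x≤y , y≤a+1)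

meetsLine⇒∈[,+1] : ∀ {c t} → MeetsLine c t → t ∈[ c - 1ℚ ,+1]
meetsLine⇒∈[,+1] {c} {t} (t≤c , c≤t+1) =
    subst (c - 1ℚ ≤_) (solve 1 (λ t → (t :+ con 1ℚ) :- con 1ℚ := t) refl t)
      (+-monoˡ-≤ (- 1ℚ) c≤t+1)
  , subst (t ≤_) (sym (p-1+1≡p c)) t≤c

∣p-q∣≤1⇒p-1≤q≤p+1 : ∀ p q → ℚ.∣ p - q ∣ ≤ 1ℚ → p - 1ℚ ≤ q × q ≤ p + 1ℚ
∣p-q∣≤1⇒p-1≤q≤p+1 p q ∣p-q∣≤1 = p-1≤q , q≤p+1
  where
  open ≤-Reasoning
  -1≤p-q = proj₁ (∣p∣≤q⇒-q≤p≤q (p - q) ∣p-q∣≤1)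
  p-q≤1 = proj₂ (∣p∣≤q⇒-q≤p≤q (p - q) ∣p-q∣≤1)

  p-1≤q : p - 1ℚ ≤ q
  p-1≤q = begin
    p - 1ℚ             ≡⟨ solve 2 (λ p q → p :- con 1ℚ := (p :- q) :+ (q :- con 1ℚ)) refl p q ⟩
    (p - q) + (q - 1ℚ) ≤⟨ +-monoˡ-≤ (q - 1ℚ) p-q≤1 ⟩
    1ℚ + (q - 1ℚ)      ≡⟨ solve 1 (λ q → con 1ℚ :+ (q :- con 1ℚ) := q) refl q ⟩
    q                  ∎

  q≤p+1 : q ≤ p + 1ℚ
  q≤p+1 = begin
    q                  ≡⟨ solve 1 (λ q → q := :- con 1ℚ :+ (q :+ con 1ℚ)) refl q ⟩
    - 1ℚ + (q + 1ℚ)    ≤⟨ +-monoˡ-≤ (q + 1ℚ) -1≤p-q ⟩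
    (p - q) + (q + 1ℚ) ≡⟨ solve 2 (λ p q → (p :- q) :+ (q :+ con 1ℚ) := p :+ con 1ℚ) refl p q ⟩
    p + 1ℚ             ∎

half : ℚ → ℚ → Fin 2
half a b with b ≤? a
... | yes _ = zero
... | no  _ = suc zero

halfStart : ℚ → Fin 2 → ℚ
halfStart a zero    = a - 1ℚ
halfStart a (suc _) = a

∈[,+1]-half : ∀ {a b} → a - 1ℚ ≤ b → b ≤ a + 1ℚ → b ∈[ halfStart a (half a b) ,+1]
∈[,+1]-half {a} {b} a-1≤b b≤a+1 with b ≤? a
... | yes b≤a = a-1≤b , subst (b ≤_) (sym (p-1+1≡p a)) b≤a
... | no  b≰a = <⇒≤ (≰⇒> b≰a) , b≤a+1

does≡true⇒ : ∀ {A : Set} (a? : Dec A) → does a? ≡ true → A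
does≡true⇒ (yes a) _ = a

squaresMeet?-sound : ∀ {s t s′ t′} → squaresMeet? s t s′ t′ ≡ true → SquaresMeet s t s′ t′
squaresMeet?-sound {s} {t} {s′} {t′} =
  does≡true⇒ ((ℚ.∣ s - s′ ∣ ≤? 1ℚ) ×-dec (ℚ.∣ t - t′ ∣ ≤? 1ℚ))

module _ {n : ℕ} {ε : ℚ} (R : Rep2SUIIG n ε) where
  open Rep2SUIIG R

  V₂⇒t∈[,+1] : ∀ {u} → InV₂ u → t u ∈[ stabLine ε true - 1ℚ ,+1]
  V₂⇒t∈[,+1] {u} u∈V₂ =
    meetsLine⇒∈[,+1] (subst (λ b → MeetsLine (stabLine ε b) (t u)) u∈V₂ (stab u))

  V₂-separated : ∀ {a u w} → InV₂ u → InV₂ w → s u ∈[ a ,+1] × s w ∈[ a ,+1] → u ≡ w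
  V₂-separated {u = u} {w} u∈V₂ w∈V₂ (su∈ , sw∈) with u ≟ w
  ... | yes u≡w = u≡w
  ... | no  u≢w = ⊥-elim (indep u w u≢w u∈V₂ w∈V₂
          (∈[,+1]⇒∣-∣≤1 su∈ sw∈ , ∈[,+1]⇒∣-∣≤1 (V₂⇒t∈[,+1] u∈V₂) (V₂⇒t∈[,+1] w∈V₂)))

  private
    ∈NB⇒upper∧meet : ∀ {v u} → u ∈ NB v →
      T (upper u) × T (squaresMeet? (s v) (t v) (s u) (t u))
    ∈NB⇒upper∧meet {v} {u} u∈NB = Equivalence.to T-∧ (Equivalence.from T-≡
      (trans (sym (lookup∘tabulate (λ w → upper w ∧ squaresMeet? (s v) (t v) (s w) (t w)) u))
             ([]=⇒lookup u∈NB)))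

  ∈NB⇒InV₂ : ∀ {v u} → u ∈ NB v → InV₂ u
  ∈NB⇒InV₂ u∈NB = Equivalence.to T-≡ (proj₁ (∈NB⇒upper∧meet u∈NB))

  ∈NB⇒s-1≤s≤s+1 : ∀ {v u} → u ∈ NB v → s v - 1ℚ ≤ s u × s u ≤ s v + 1ℚ
  ∈NB⇒s-1≤s≤s+1 {v} {u} u∈NB = ∣p-q∣≤1⇒p-1≤q≤p+1 (s v) (s u) (proj₁
    (squaresMeet?-sound {s v} {t v} {s u} {t u} (Equivalence.to T-≡ (proj₂ (∈NB⇒upper∧meet u∈NB)))))

  ∣NB∣≤2 : ∀ v → ∣ NB v ∣ ℕ.≤ 2
  ∣NB∣≤2 v = injectiveOn⇒∣p∣≤ (half (s v) ∘ s) same-half⇒≡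
    where
    ∈half : ∀ {u} → u ∈ NB v → s u ∈[ halfStart (s v) (half (s v) (s u)) ,+1]
    ∈half u∈NB = ∈[,+1]-half (proj₁ (∈NB⇒s-1≤s≤s+1 u∈NB)) (proj₂ (∈NB⇒s-1≤s≤s+1 u∈NB))

    same-half⇒≡ : ∀ {i j} → i ∈ NB v → j ∈ NB v →
      half (s v) (s i) ≡ half (s v) (s j) → i ≡ j
    same-half⇒≡ {i} {j} i∈NB j∈NB same-half =
      V₂-separated (∈NB⇒InV₂ i∈NB) (∈NB⇒InV₂ j∈NB)
        (∈half i∈NB , subst (λ h → s j ∈[ halfStart (s v) h ,+1]) (sym same-half) (∈half j∈NB))

  NB-no-V₂-between : ∀ {v x y z} → x ∈ NB v → z ∈ NB v → InV₂ y →
    ¬ (s x < s y × s y < s z)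
  NB-no-V₂-between {v} {x} {y} {z} x∈NB z∈NB y∈V₂ (sx<sy , sy<sz) =
    [ y-left , y-right ] (≤-total (s y) (s v))
    where
    y-left : s y ≤ s v → ⊥
    y-left sy≤sv = <-irrefl (cong s (V₂-separated (∈NB⇒InV₂ x∈NB) y∈V₂
      (ordered⇒∈[,+1] (proj₁ (∈NB⇒s-1≤s≤s+1 x∈NB)) (<⇒≤ sx<sy)
         (subst (s y ≤_) (sym (p-1+1≡p (s v))) sy≤sv)))) sx<sy

    y-right : s v ≤ s y → ⊥
    y-right sv≤sy = <-irrefl (cong s (V₂-separated y∈V₂ (∈NB⇒InV₂ z∈NB)
      (ordered⇒∈[,+1] sv≤sy (<⇒≤ sy<sz) (proj₂ (∈NB⇒s-1≤s≤s+1 z∈NB))))) sy<sz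

lemma6 : (n : ℕ) (ε : ℚ) → 0ℚ < ε → ε < 1ℚ → (R : Rep2SUIIG n ε) →
    (∀ v → Rep2SUIIG.InV₁ R v → ∣ Rep2SUIIG.NB R v ∣ ℕ.≤ 2)
    × (∀ v x z → Rep2SUIIG.InV₁ R v → Rep2SUIIG.NB R v ≡ ⁅ x ⁆ ∪ ⁅ z ⁆ →
        ∀ y → Rep2SUIIG.InV₂ R y →
        ¬ ((Rep2SUIIG.s R x < Rep2SUIIG.s R y) × (Rep2SUIIG.s R y < Rep2SUIIG.s R z)))
lemma6 n ε _ _ R =
    (λ v _ → ∣NB∣≤2 R v)
  , λ v x z _ NB≡x∪z y y∈V₂ → NB-no-V₂-between R
      (subst (x ∈_) (sym NB≡x∪z) (p⊆p∪q ⁅ z ⁆ (x∈⁅x⁆ x)))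
      (subst (z ∈_) (sym NB≡x∪z) (q⊆p∪q ⁅ x ⁆ ⁅ z ⁆ (x∈⁅x⁆ z)))
      y∈V₂
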